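{- Let $n$ be a positive integer and let $G=P_3\Box P_n$. There is no path cover $\mathcal P$ of $G$ with all of the following properties: (i) $\mathcal E(\mathcal P)\subseteq\{2\}\times[n]$; (ii) for some odd integer $k\in[n]$, $(2,k)\in\mathcal E(\mathcal P)$ and $(2,k-1)\notin\mathcal E(\mathcal P)$; (iii) for every odd integer $i$ with $1\le i<k$, $(2,i)\in\mathcal E(\mathcal P)$ if and only if $(2,i-1)\in\mathcal E(\mathcal P)$ (here $(2,0)$ is not a vertex of $G$, so in particular $(2,0)\notin\mathcal E(\mathcal P)$).
   Context: For a positive integer $m$, $[m]=\{1,\dots,m\}$. $P_m$ denotes the path with vertex set $[m]$ and edges $\{i,i+1\}$ for $1\le i<m$. The Cartesian product $G\Box H$ has vertex set $V(G)\times V(H)$, with $(g_1,h_1)$ adjacent to $(g_2,h_2)$ iff either $g_1=g_2$ and $h_1h_2\in E(H)$, or $g_1g_2\in E(G)$ and $h_1=h_2$. So vertices of $P_3\Box P_n$ are pairs $(x,y)$ with $x\in[3]$, $y\in[n]$. A path cover (path factor) of a graph $G$ is a set $\mathcal P$ of pairwise vertex-disjoint paths in $G$, each with at least two vertices, whose vertex sets together cover $V(G)$. $\mathcal E(\mathcal P)$ denotes the set of endvertices of the paths in $\mathcal P$. -}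

module Defs where

open import Data.Nat using (ℕ; zero; suc; _+_; _*_; _∸_; _≤_; _<_)
open import Data.Product using (Σ; ∃; _×_; _,_; proj₁; proj₂)
open import Data.Sum using (_⊎_)
open import Data.List using (List; []; _∷_; _∷ʳ_; length)
open import Data.List.Relation.Unary.All using (All)
open import Data.List.Relation.Unary.Any using (Any)
open import Data.List.Relation.Unary.AllPairs using (AllPairs)
open import Data.List.Relation.Unary.Linked using (Linked)
open import Data.List.Membership.Propositional using (_∈_)
open import Relation.Nullary using (¬_)
open import Relation.Binary.PropositionalEquality using (_≡_)

Vertex : Set
Vertex = ℕ × ℕ

InGrid : ℕ → Vertex → Set
InGrid n (x , y) = (1 ≤ x × x ≤ 3) × (1 ≤ y × y ≤ n)

Adj : Vertex → Vertex → Set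
Adj (x₁ , y₁) (x₂ , y₂) =
  (x₁ ≡ x₂ × (suc y₁ ≡ y₂ ⊎ suc y₂ ≡ y₁)) ⊎
  (y₁ ≡ y₂ × (suc x₁ ≡ x₂ ⊎ suc x₂ ≡ x₁))

IsPath : ℕ → List Vertex → Set
IsPath n p = All (InGrid n) p × AllPairs (λ u v → ¬ u ≡ v) p × Linked Adj p × 2 ≤ length p

Disjoint : List Vertex → List Vertex → Set
Disjoint p q = ∀ v → v ∈ p → ¬ v ∈ q

IsPathCover : ℕ → List (List Vertex) → Set
IsPathCover n ps =
  All (IsPath n) ps × AllPairs Disjoint ps × (∀ v → InGrid n v → Any (v ∈_) ps)

EndOf : List Vertex → Vertex → Set
EndOf p v = (∃ λ r → p ≡ v ∷ r) ⊎ (∃ λ r → p ≡ r ∷ʳ v)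

IsEnd : List (List Vertex) → Vertex → Set
IsEnd ps v = Any (λ p → EndOf p v) ps

Odd : ℕ → Set
Odd k = ∃ λ j → k ≡ suc (2 * j)

-- In a path cover every vertex has degree 2, minus 1 if it is an endvertex, and by (i) all endvertices
-- lie in the middle row. Let S y and H y count the cover edges between columns y and y + 1 in the outer
-- rows and in the middle row, and let e y indicate that (2 , y) is an endvertex. Adding the degree
-- equations of the top and the bottom vertex of column y and subtracting that of the middle one gives
-- S y + S (y - 1) = 2 + e y + H y + H (y - 1), with S 0 = H 0 = e 0 = 0. Hence for odd m,
-- S m + e (m - 1) = 2 + e m + H m as long as e i = e (i - 1) at every odd i < m, which is (iii).
-- At m = k, hypothesis (ii) turns this into S k = 3 + H k, impossible since S k ≤ 2.

module Submission where

open import Defs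
open import Level using (0ℓ)
open import Data.Nat using (ℕ; zero; suc; pred; _+_; _*_; _∸_; _≤_; _<_; z≤n; s≤s; _≟_)
open import Data.Nat.Properties using (+-cancelʳ-≡; +-identityʳ; +-assoc; +-mono-≤; ≤-refl; ≤-trans; n≤1+n; *-suc)
open import Data.Nat.Tactic.RingSolver using (solve-∀)
open import Data.Product using (∃; ∃₂; _×_; _,_; proj₁; proj₂)
import Data.Product as Product
open import Data.Product.Properties using (≡-dec)
open import Data.Sum using (_⊎_; inj₁; inj₂; swap)
import Data.Sum as Sum
open import Data.Empty using (⊥; ⊥-elim)
open import Data.List using (List; []; _∷_; _∷ʳ_; length; initLast; _∷ʳ′_)
open import Data.List.Properties using (∷ʳ-injective)
import Data.List.Relation.Unary.All as All
open import Data.List.Relation.Unary.All using ([]; _∷_)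
open import Data.List.Relation.Unary.All.Properties using (All¬⇒¬Any)
import Data.List.Relation.Unary.Any as Any
open import Data.List.Relation.Unary.Any using (Any; here; there; any?)
import Data.List.Relation.Unary.AllPairs as AllPairs
open import Data.List.Relation.Unary.AllPairs using (AllPairs; []; _∷_)
open import Data.List.Relation.Unary.Linked using (Linked; _∷_)
open import Data.List.Relation.Unary.Unique.Propositional using (Unique)
open import Data.List.Membership.Propositional using (_∈_; _∉_; find; lose)
open import Data.List.Membership.Propositional.Properties using (∈-AllPairs₂; ∈-++⁺ʳ)
open import Function using (_∘_)
open import Function.Bundles using (_⇔_; mk⇔; Equivalence)
open import Relation.Nullary using (¬_; Dec; yes; no)
open import Relation.Nullary.Decidable using (_⊎-dec_; _×-dec_; map′)
open import Relation.Unary using (Pred; Decidable; _≐_; ｛_｝; _∪_)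
open import Relation.Unary.Properties using (_∪?_; ≐-trans)
open import Relation.Binary.Definitions using (DecidableEquality)
open import Relation.Binary.PropositionalEquality
  using (_≡_; _≢_; refl; sym; trans; cong; cong₂; subst; module ≡-Reasoning)

open ≡-Reasoning

-- Counting

indicator : {P : Set} → Dec P → ℕ
indicator (yes _) = 1
indicator (no _)  = 0

indicator-≡1 : {P : Set} → P → (P? : Dec P) → indicator P? ≡ 1
indicator-≡1 _ (yes _) = refl
indicator-≡1 p (no ¬p) = ⊥-elim (¬p p)

indicator-≡0 : {P : Set} → ¬ P → (P? : Dec P) → indicator P? ≡ 0
indicator-≡0 ¬p (yes p) = ⊥-elim (¬p p)
indicator-≡0 ¬p (no _)  = refl

indicator-≤1 : {P : Set} (P? : Dec P) → indicator P? ≤ 1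
indicator-≤1 (yes _) = s≤s z≤n
indicator-≤1 (no _)  = z≤n

indicator-cong : {P Q : Set} → P ⇔ Q → (P? : Dec P) (Q? : Dec Q) → indicator P? ≡ indicator Q?
indicator-cong P⇔Q (yes p) Q? = sym (indicator-≡1 (Equivalence.to P⇔Q p) Q?)
indicator-cong P⇔Q (no ¬p) Q? = sym (indicator-≡0 (¬p ∘ Equivalence.from P⇔Q) Q?)

indicator-⊎ : {P Q : Set} → (P → ¬ Q) → (P? : Dec P) (Q? : Dec Q) →
              indicator (P? ⊎-dec Q?) ≡ indicator P? + indicator Q?
indicator-⊎ P⇒¬Q (yes p) (yes q) = ⊥-elim (P⇒¬Q p q)
indicator-⊎ P⇒¬Q (yes p) (no _)  = refl
indicator-⊎ P⇒¬Q (no _)  (yes q) = refl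
indicator-⊎ P⇒¬Q (no _)  (no _)  = refl

module _ {A : Set} where

  count : {P : Pred A 0ℓ} → Decidable P → List A → ℕ
  count P? []       = 0
  count P? (x ∷ xs) = indicator (P? x) + count P? xs

  count-cong : {P Q : Pred A 0ℓ} → P ≐ Q → (P? : Decidable P) (Q? : Decidable Q) →
               ∀ xs → count P? xs ≡ count Q? xs
  count-cong _ P? Q? [] = refl
  count-cong P≐Q@(P⊆Q , Q⊆P) P? Q? (x ∷ xs) =
    cong₂ _+_ (indicator-cong (mk⇔ P⊆Q Q⊆P) (P? x) (Q? x)) (count-cong P≐Q P? Q? xs)

  count-∪ : {P Q : Pred A 0ℓ} → (∀ {x} → P x → ¬ Q x) → (P? : Decidable P) (Q? : Decidable Q) →
            ∀ xs → count (P? ∪? Q?) xs ≡ count P? xs + count Q? xs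
  count-∪ _ P? Q? [] = refl
  count-∪ P⇒¬Q P? Q? (x ∷ xs) = begin
    indicator (P? x ⊎-dec Q? x) + count (P? ∪? Q?) xs
      ≡⟨ cong₂ _+_ (indicator-⊎ P⇒¬Q (P? x) (Q? x)) (count-∪ P⇒¬Q P? Q? xs) ⟩
    (indicator (P? x) + indicator (Q? x)) + (count P? xs + count Q? xs)
      ≡⟨ interchange (indicator (P? x)) (indicator (Q? x)) (count P? xs) (count Q? xs) ⟩
    (indicator (P? x) + count P? xs) + (indicator (Q? x) + count Q? xs) ∎
    where
    interchange : ∀ a b c d → (a + b) + (c + d) ≡ (a + c) + (b + d)
    interchange = solve-∀

  count-≡0 : {P : Pred A 0ℓ} (P? : Decidable P) → ∀ xs → (∀ {x} → x ∈ xs → ¬ P x) → count P? xs ≡ 0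
  count-≡0 P? []       _  = refl
  count-≡0 P? (x ∷ xs) ¬P = cong₂ _+_ (indicator-≡0 (¬P (here refl)) (P? x)) (count-≡0 P? xs (¬P ∘ there))

  count-｛｝ : (_≟ₐ_ : DecidableEquality A) → ∀ {w xs} → Unique xs → w ∈ xs → count (w ≟ₐ_) xs ≡ 1
  count-｛｝ _≟ₐ_ {xs = x ∷ xs} (x∉xs ∷ _) (here refl) =
    cong₂ _+_ (indicator-≡1 refl (x ≟ₐ x)) (count-≡0 (x ≟ₐ_) xs (All.lookup x∉xs))
  count-｛｝ _≟ₐ_ {w} {x ∷ xs} (x∉xs ∷ xs-unique) (there w∈xs) =
    cong₂ _+_ (indicator-≡0 (λ w≡x → All.lookup x∉xs w∈xs (sym w≡x)) (w ≟ₐ x)) (count-｛｝ _≟ₐ_ xs-unique w∈xs)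

-- Neighbourhoods of vertices on a path

PathNeighbourhood : {A : Set} → Pred A 0ℓ → Set → Set
PathNeighbourhood N E =
  (E × ∃ λ w → N ≐ ｛ w ｝) ⊎ (¬ E × ∃₂ λ w₁ w₂ → w₁ ≢ w₂ × N ≐ ｛ w₁ ｝ ∪ ｛ w₂ ｝)

PathNeighbourhood-resp : {A : Set} {N N′ : Pred A 0ℓ} {E E′ : Set} →
                         N ≐ N′ → E ⇔ E′ → PathNeighbourhood N E → PathNeighbourhood N′ E′
PathNeighbourhood-resp (N⊆N′ , N′⊆N) E⇔E′ (inj₁ (e , w , N≐)) =
  inj₁ (Equivalence.to E⇔E′ e , w , ≐-trans (N′⊆N , N⊆N′) N≐)
PathNeighbourhood-resp (N⊆N′ , N′⊆N) E⇔E′ (inj₂ (¬e , w₁ , w₂ , w₁≢w₂ , N≐)) =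
  inj₂ (¬e ∘ Equivalence.from E⇔E′ , w₁ , w₂ , w₁≢w₂ , ≐-trans (N′⊆N , N⊆N′) N≐)

count-PathNeighbourhood : {A : Set} (_≟ₐ_ : DecidableEquality A) {N : Pred A 0ℓ} {E : Set} {xs : List A} →
                          Unique xs → (∀ {w} → N w → w ∈ xs) → (N? : Decidable N) (E? : Dec E) →
                          PathNeighbourhood N E → count N? xs + indicator E? ≡ 2
count-PathNeighbourhood _≟ₐ_ {xs = xs} xs-unique N⊆xs N? E? (inj₁ (e , w , N≐)) = begin
  count N? xs + indicator E?      ≡⟨ cong₂ _+_ (count-cong N≐ N? (w ≟ₐ_) xs) (indicator-≡1 e E?) ⟩
  count (w ≟ₐ_) xs + 1           ≡⟨ cong (_+ 1) (count-｛｝ _≟ₐ_ xs-unique (N⊆xs (proj₂ N≐ refl))) ⟩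
  2                               ∎
count-PathNeighbourhood _≟ₐ_ {xs = xs} xs-unique N⊆xs N? E? (inj₂ (¬e , w₁ , w₂ , w₁≢w₂ , N≐)) = begin
  count N? xs + indicator E?
    ≡⟨ cong₂ _+_ (count-cong N≐ N? ((w₁ ≟ₐ_) ∪? (w₂ ≟ₐ_)) xs) (indicator-≡0 ¬e E?) ⟩
  count ((w₁ ≟ₐ_) ∪? (w₂ ≟ₐ_)) xs + 0
    ≡⟨ cong (_+ 0) (count-∪ (λ { refl refl → w₁≢w₂ refl }) (w₁ ≟ₐ_) (w₂ ≟ₐ_) xs) ⟩
  count (w₁ ≟ₐ_) xs + count (w₂ ≟ₐ_) xs + 0
    ≡⟨ cong₂ (λ a b → a + b + 0) (count-｛｝ _≟ₐ_ xs-unique (N⊆xs (proj₂ N≐ (inj₁ refl))))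
                                 (count-｛｝ _≟ₐ_ xs-unique (N⊆xs (proj₂ N≐ (inj₂ refl)))) ⟩
  2 ∎

data Consecutive {A : Set} : List A → A → A → Set where
  here  : ∀ {u w r} → Consecutive (u ∷ w ∷ r) u w
  there : ∀ {x r u w} → Consecutive r u w → Consecutive (x ∷ r) u w

AdjacentOn : {A : Set} → List A → A → A → Set
AdjacentOn p u w = Consecutive p u w ⊎ Consecutive p w u

module _ {A : Set} where

  Consecutive-∈ˡ : ∀ {p u w} → Consecutive {A} p u w → u ∈ p
  Consecutive-∈ˡ here      = here refl
  Consecutive-∈ˡ (there c) = there (Consecutive-∈ˡ c)

  Consecutive-∈ʳ : ∀ {p u w} → Consecutive {A} p u w → w ∈ p
  Consecutive-∈ʳ here      = there (here refl)
  Consecutive-∈ʳ (there c) = there (Consecutive-∈ʳ c)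

  AdjacentOn-∈ˡ : ∀ {p u w} → AdjacentOn {A} p u w → u ∈ p
  AdjacentOn-∈ˡ = Sum.[ Consecutive-∈ˡ , Consecutive-∈ʳ ]

  AdjacentOn-∈ʳ : ∀ {p u w} → AdjacentOn {A} p u w → w ∈ p
  AdjacentOn-∈ʳ = Sum.[ Consecutive-∈ʳ , Consecutive-∈ˡ ]

  Linked-Consecutive : ∀ {R : A → A → Set} {p u w} → Linked R p → Consecutive p u w → R u w
  Linked-Consecutive (Ruw ∷ _) here      = Ruw
  Linked-Consecutive (_ ∷ lk)  (there c) = Linked-Consecutive lk c

  consecutive? : DecidableEquality A → ∀ p u w → Dec (Consecutive p u w)
  consecutive? _≟ₐ_ []          u w = no λ ()
  consecutive? _≟ₐ_ (x ∷ [])    u w = no λ { (there ()) }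
  consecutive? _≟ₐ_ (x ∷ y ∷ r) u w =
    map′ (Sum.[ (λ { (refl , refl) → here }) , there ]) (λ { here → inj₁ (refl , refl) ; (there c) → inj₂ c })
         (((x ≟ₐ u) ×-dec (y ≟ₐ w)) ⊎-dec consecutive? _≟ₐ_ (y ∷ r) u w)

  AdjacentOn-∷⁻ : ∀ {x y r v w} → AdjacentOn (x ∷ y ∷ r) v w →
                  (x ≡ v × y ≡ w) ⊎ (y ≡ v × x ≡ w) ⊎ AdjacentOn {A} (y ∷ r) v w
  AdjacentOn-∷⁻ (inj₁ here)      = inj₁ (refl , refl)
  AdjacentOn-∷⁻ (inj₂ here)      = inj₂ (inj₁ (refl , refl))
  AdjacentOn-∷⁻ (inj₁ (there c)) = inj₂ (inj₂ (inj₁ c))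
  AdjacentOn-∷⁻ (inj₂ (there c)) = inj₂ (inj₂ (inj₂ c))

  AdjacentOn-there : ∀ {x q v w} → AdjacentOn {A} q v w → AdjacentOn (x ∷ q) v w
  AdjacentOn-there = Sum.map there there

  ∷≡∷ʳ⁻ : ∀ {x : A} {q s v} → x ∷ q ≡ s ∷ʳ v → (q ≡ [] × x ≡ v) ⊎ ∃ λ s′ → q ≡ s′ ∷ʳ v
  ∷≡∷ʳ⁻ {s = []}     refl = inj₁ (refl , refl)
  ∷≡∷ʳ⁻ {s = _ ∷ s′} refl = inj₂ (s′ , refl)

  ∷ʳ-∈ : ∀ {q s} {v : A} → q ≡ s ∷ʳ v → v ∈ q
  ∷ʳ-∈ {s = s} refl = ∈-++⁺ʳ s (here refl)

  first-neighbourhood : ∀ {x y r} → x ∉ y ∷ r → AdjacentOn {A} (x ∷ y ∷ r) x ≐ ｛ y ｝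
  first-neighbourhood {x} {y} {r} x∉q = ⊆ , λ { refl → inj₁ here }
    where
    ⊆ : ∀ {w} → AdjacentOn (x ∷ y ∷ r) x w → y ≡ w
    ⊆ a with AdjacentOn-∷⁻ a
    ... | inj₁ (_ , y≡w)        = y≡w
    ... | inj₂ (inj₁ (y≡x , _)) = ⊥-elim (x∉q (here (sym y≡x)))
    ... | inj₂ (inj₂ a′)        = ⊥-elim (x∉q (AdjacentOn-∈ˡ a′))

  second-of-two-neighbourhood : ∀ {x y} → x ≢ y → AdjacentOn {A} (x ∷ y ∷ []) y ≐ ｛ x ｝
  second-of-two-neighbourhood {x} {y} x≢y = ⊆ , λ { refl → inj₂ here }
    where
    ⊆ : ∀ {w} → AdjacentOn (x ∷ y ∷ []) y w → x ≡ w
    ⊆ (inj₁ here)         = ⊥-elim (x≢y refl)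
    ⊆ (inj₂ here)         = refl
    ⊆ (inj₁ (there (there ())))
    ⊆ (inj₂ (there (there ())))

  second-neighbourhood : ∀ {x y r w} → x ∉ y ∷ r → AdjacentOn (y ∷ r) y ≐ ｛ w ｝ →
                         AdjacentOn {A} (x ∷ y ∷ r) y ≐ ｛ x ｝ ∪ ｛ w ｝
  second-neighbourhood {x} {y} {r} {w} x∉q (N⊆ , ⊆N) = ⊆ , ⊇
    where
    ⊆ : ∀ {u} → AdjacentOn (x ∷ y ∷ r) y u → x ≡ u ⊎ w ≡ u
    ⊆ a with AdjacentOn-∷⁻ a
    ... | inj₁ (x≡y , _)        = ⊥-elim (x∉q (here x≡y))
    ... | inj₂ (inj₁ (_ , x≡u)) = inj₁ x≡u
    ... | inj₂ (inj₂ a′)        = inj₂ (N⊆ a′)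
    ⊇ : ∀ {u} → x ≡ u ⊎ w ≡ u → AdjacentOn (x ∷ y ∷ r) y u
    ⊇ (inj₁ refl) = inj₂ here
    ⊇ (inj₂ w≡u)  = AdjacentOn-there (⊆N w≡u)

  AdjacentOn-∷-≐ : ∀ {x y r v} → x ≢ v → y ≢ v → AdjacentOn {A} (x ∷ y ∷ r) v ≐ AdjacentOn (y ∷ r) v
  AdjacentOn-∷-≐ x≢v y≢v = ⊆ , AdjacentOn-there
    where
    ⊆ : ∀ {u} → AdjacentOn _ _ u → AdjacentOn _ _ u
    ⊆ a with AdjacentOn-∷⁻ a
    ... | inj₁ (x≡v , _)        = ⊥-elim (x≢v x≡v)
    ... | inj₂ (inj₁ (y≡v , _)) = ⊥-elim (y≢v y≡v)
    ... | inj₂ (inj₂ a′)        = a′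

EndOf-∷⁻ : ∀ {x q v} → EndOf (x ∷ q) v → x ≡ v ⊎ ∃ λ s → q ≡ s ∷ʳ v
EndOf-∷⁻ (inj₁ (_ , refl)) = inj₁ refl
EndOf-∷⁻ (inj₂ (_ , eq))   = Sum.map₁ proj₂ (∷≡∷ʳ⁻ eq)

EndOf-∷-⇔ : ∀ {x y r v} → x ≢ v → y ≢ v → EndOf (x ∷ y ∷ r) v ⇔ EndOf (y ∷ r) v
EndOf-∷-⇔ {x} x≢v y≢v = mk⇔ to from
  where
  to : EndOf _ _ → EndOf _ _
  to e with EndOf-∷⁻ e
  ... | inj₁ x≡v  = ⊥-elim (x≢v x≡v)
  ... | inj₂ last = inj₂ last
  from : EndOf _ _ → EndOf _ _
  from (inj₁ (_ , refl)) = ⊥-elim (y≢v refl)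
  from (inj₂ (s , eq))     = inj₂ (x ∷ s , cong (x ∷_) eq)

second-not-EndOf : ∀ {x y z r} → x ≢ y → y ∉ z ∷ r → ¬ EndOf (x ∷ y ∷ z ∷ r) y
second-not-EndOf x≢y y∉ e with EndOf-∷⁻ e
... | inj₁ x≡y = x≢y x≡y
... | inj₂ (_ , eq) with ∷≡∷ʳ⁻ eq
...   | inj₁ (() , _)
...   | inj₂ (_ , eq′) = y∉ (∷ʳ-∈ eq′)

_≟ᵥ_ : DecidableEquality Vertex
_≟ᵥ_ = ≡-dec _≟_ _≟_

pathNeighbourhood : ∀ {p v} → AllPairs _≢_ p → 2 ≤ length p → v ∈ p →
                    PathNeighbourhood (AdjacentOn p v) (EndOf p v)
pathNeighbourhood {_ ∷ []} _ (s≤s ()) _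
pathNeighbourhood {x ∷ y ∷ r} (x≢q ∷ _) _ (here refl) =
  inj₁ (inj₁ (y ∷ r , refl) , y , first-neighbourhood (All¬⇒¬Any x≢q))
pathNeighbourhood {x ∷ y ∷ []} (x≢q ∷ _) _ (there (here refl)) =
  inj₁ (inj₂ (x ∷ [] , refl) , x , second-of-two-neighbourhood (All.head x≢q))
pathNeighbourhood {x ∷ y ∷ z ∷ r} {v} (x≢q ∷ q-distinct) _ (there v∈q)
  with pathNeighbourhood q-distinct (s≤s (s≤s z≤n)) v∈q | y ≟ᵥ v
... | inj₁ (_ , w , N≐) | yes refl =
  inj₂ ( second-not-EndOf (All.head x≢q) (All¬⇒¬Any (AllPairs.head q-distinct))
       , x , w , All.lookup x≢q (AdjacentOn-∈ʳ (proj₂ N≐ refl))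
       , second-neighbourhood (All¬⇒¬Any x≢q) N≐)
... | inj₁ (e , w , N≐) | no y≢v =
  inj₁ ( Equivalence.from (EndOf-∷-⇔ (All.lookup x≢q v∈q) y≢v) e
       , w , ≐-trans (AdjacentOn-∷-≐ (All.lookup x≢q v∈q) y≢v) N≐)
... | inj₂ (¬e , _) | yes refl = ⊥-elim (¬e (inj₁ (_ , refl)))
... | inj₂ (¬e , w₁ , w₂ , w₁≢w₂ , N≐) | no y≢v =
  inj₂ ( ¬e ∘ Equivalence.to (EndOf-∷-⇔ (All.lookup x≢q v∈q) y≢v)
       , w₁ , w₂ , w₁≢w₂ , ≐-trans (AdjacentOn-∷-≐ (All.lookup x≢q v∈q) y≢v) N≐)

-- Degrees in a path cover of the grid

EdgeOf : List (List Vertex) → Vertex → Vertex → Set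
EdgeOf ps u w = Any (λ p → AdjacentOn p u w) ps

Any⇔at-host : ∀ {Q : List Vertex → Set} {ps p v} → AllPairs Disjoint ps → p ∈ ps → v ∈ p →
              (∀ {q} → Q q → v ∈ q) → Q p ⇔ Any Q ps
Any⇔at-host {Q} {ps} {p} {v} disjoint p∈ps v∈p Q⇒∋v = mk⇔ (lose p∈ps) from
  where
  from : Any Q ps → Q p
  from any with find any
  ... | q , q∈ps , Qq with ∈-AllPairs₂ disjoint q∈ps p∈ps
  ...   | inj₁ refl         = Qq
  ...   | inj₂ (inj₁ q∩p≡∅) = ⊥-elim (q∩p≡∅ v (Q⇒∋v Qq) v∈p)
  ...   | inj₂ (inj₂ p∩q≡∅) = ⊥-elim (p∩q≡∅ v v∈p (Q⇒∋v Qq))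

EndOf-∈ : ∀ {p v} → EndOf p v → v ∈ p
EndOf-∈ (inj₁ (_ , refl)) = here refl
EndOf-∈ (inj₂ (_ , eq))   = ∷ʳ-∈ eq

coverNeighbourhood : ∀ {n ps v} → IsPathCover n ps → InGrid n v →
                     PathNeighbourhood (EdgeOf ps v) (IsEnd ps v)
coverNeighbourhood (paths , disjoint , covers) v∈G with find (covers _ v∈G)
... | p , p∈ps , v∈p with All.lookup paths p∈ps
...   | _ , distinct , _ , long =
  PathNeighbourhood-resp
    ((λ a → Equivalence.to (on-host AdjacentOn-∈ˡ) a) , (λ a → Equivalence.from (on-host AdjacentOn-∈ˡ) a))
    (on-host EndOf-∈)
    (pathNeighbourhood distinct long v∈p)
  where
  on-host : ∀ {Q : List Vertex → Set} → (∀ {q} → Q q → _ ∈ q) → Q p ⇔ Any Q _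
  on-host = Any⇔at-host disjoint p∈ps v∈p

Any⇒InGrid : ∀ {n ps v} {Q : List Vertex → Set} → IsPathCover n ps → (∀ {q} → Q q → v ∈ q) → Any Q ps → InGrid n v
Any⇒InGrid (paths , _) Q⇒∋v any with find any
... | q , q∈ps , Qq = All.lookup (proj₁ (All.lookup paths q∈ps)) (Q⇒∋v Qq)

adjacentOn? : ∀ p u w → Dec (AdjacentOn p u w)
adjacentOn? p u w = consecutive? _≟ᵥ_ p u w ⊎-dec consecutive? _≟ᵥ_ p w u

edgeOf? : ∀ ps u → Decidable (EdgeOf ps u)
edgeOf? ps u w = any? (λ p → adjacentOn? p u w) ps

endOf? : ∀ p v → Dec (EndOf p v)
endOf? p v = starts? p ⊎-dec ends? p
  where
  starts? : ∀ p → Dec (∃ λ r → p ≡ v ∷ r)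
  starts? []      = no λ ()
  starts? (x ∷ r) = map′ (λ { refl → r , refl }) (λ { (_ , refl) → refl }) (x ≟ᵥ v)
  ends? : ∀ p → Dec (∃ λ s → p ≡ s ∷ʳ v)
  ends? p with initLast p
  ... | []      = no λ { ([] , ()) ; (_ ∷ _ , ()) }
  ... | s ∷ʳ′ x = map′ (λ { refl → s , refl }) (λ (s′ , eq) → proj₂ (∷ʳ-injective s s′ eq)) (x ≟ᵥ v)

isEnd? : ∀ ps v → Dec (IsEnd ps v)
isEnd? ps v = any? (λ p → endOf? p v) ps

gridNeighbours : Vertex → List Vertex
gridNeighbours (x , y) = (x , suc y) ∷ (x , pred y) ∷ (suc x , y) ∷ (pred x , y) ∷ []

gridNeighbours-unique : ∀ x y → Unique (gridNeighbours (suc x , suc y))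
gridNeighbours-unique x y =
  ((λ ()) ∷ (λ ()) ∷ (λ ()) ∷ []) ∷ ((λ ()) ∷ (λ ()) ∷ []) ∷ ((λ ()) ∷ []) ∷ [] ∷ []

Adj⇒∈gridNeighbours : ∀ {v w} → Adj v w → w ∈ gridNeighbours v
Adj⇒∈gridNeighbours (inj₁ (refl , inj₁ refl)) = here refl
Adj⇒∈gridNeighbours (inj₁ (refl , inj₂ refl)) = there (here refl)
Adj⇒∈gridNeighbours (inj₂ (refl , inj₁ refl)) = there (there (here refl))
Adj⇒∈gridNeighbours (inj₂ (refl , inj₂ refl)) = there (there (there (here refl)))

Adj-sym : ∀ {u w} → Adj u w → Adj w u
Adj-sym = Sum.map (Product.map sym swap) (Product.map sym swap)

EdgeOf⇒Adj : ∀ {n ps u w} → IsPathCover n ps → EdgeOf ps u w → Adj u w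
EdgeOf⇒Adj (paths , _) e with find e
... | q , q∈ps , a with All.lookup paths q∈ps
...   | _ , _ , linked , _ = Sum.[ Linked-Consecutive linked , Adj-sym ∘ Linked-Consecutive linked ] a

degree : List (List Vertex) → Vertex → ℕ
degree ps v = count (edgeOf? ps v) (gridNeighbours v)

endCount : List (List Vertex) → Vertex → ℕ
endCount ps v = indicator (isEnd? ps v)

degree-+-endCount : ∀ {n ps v} → IsPathCover n ps → InGrid n v → degree ps v + endCount ps v ≡ 2
degree-+-endCount {ps = ps} {v = suc x , suc y} C v∈G =
  count-PathNeighbourhood _≟ᵥ_ (gridNeighbours-unique x y) (Adj⇒∈gridNeighbours ∘ EdgeOf⇒Adj C)
    (edgeOf? ps _) (isEnd? ps _) (coverNeighbourhood C v∈G)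
degree-+-endCount {v = zero , _} _ ((() , _) , _)
degree-+-endCount {v = _ , zero} _ (_ , (() , _))

edge : List (List Vertex) → Vertex → Vertex → ℕ
edge ps u w = indicator (edgeOf? ps u w)

edge-sym : ∀ ps u w → edge ps u w ≡ edge ps w u
edge-sym ps u w = indicator-cong (mk⇔ (Any.map swap) (Any.map swap)) (edgeOf? ps u w) (edgeOf? ps w u)

edge-outside : ∀ {n ps u} w → IsPathCover n ps → ¬ InGrid n u → edge ps u w ≡ 0
edge-outside {ps = ps} {u} w C u∉G = indicator-≡0 (u∉G ∘ Any⇒InGrid C AdjacentOn-∈ˡ) (edgeOf? ps u w)

horizontal vertical : List (List Vertex) → ℕ → ℕ → ℕ
horizontal ps x y = edge ps (x , y) (x , suc y)
vertical   ps x y = edge ps (x , y) (suc x , y)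

vertex-balance : ∀ {n ps x y} → IsPathCover n ps → InGrid n (suc x , suc y) →
                horizontal ps (suc x) (suc y) + horizontal ps (suc x) y
                  + vertical ps (suc x) (suc y) + vertical ps x (suc y) + endCount ps (suc x , suc y) ≡ 2
vertex-balance {ps = ps} {x} {y} C v∈G = begin
  h + horizontal ps (suc x) y + vb + vertical ps x (suc y) + endCount ps v
    ≡⟨ cong₂ (λ h′ v′ → h + h′ + vb + v′ + endCount ps v) (edge-sym ps _ _) (edge-sym ps _ _) ⟩
  h + edge ps v (suc x , y) + vb + edge ps v (x , suc y) + endCount ps v
    ≡⟨ cong (_+ endCount ps v) (unfold h (edge ps v (suc x , y)) vb (edge ps v (x , suc y))) ⟩
  degree ps v + endCount ps v
    ≡⟨ degree-+-endCount C v∈G ⟩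
  2 ∎
  where
  v = (suc x , suc y)
  h = horizontal ps (suc x) (suc y)
  vb = vertical ps (suc x) (suc y)
  unfold : ∀ a b c d → a + b + c + d ≡ a + (b + (c + (d + 0)))
  unfold = solve-∀

-- The column invariant

module _ (S H e : ℕ → ℕ) where

  Balanced : ℕ → Set
  Balanced y = S (suc y) + S y ≡ 2 + e (suc y) + H (suc y) + H y

  Invariant : ℕ → Set
  Invariant m = S (suc m) + e m ≡ 2 + e (suc m) + H (suc m)

  invariant-start : S 0 ≡ 0 → H 0 ≡ 0 → e 0 ≡ 0 → Balanced 0 → Invariant 0
  invariant-start S₀ H₀ e₀ balanced₀ = begin
    S 1 + e 0               ≡⟨ cong (S 1 +_) (trans e₀ (sym S₀)) ⟩
    S 1 + S 0               ≡⟨ balanced₀ ⟩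
    2 + e 1 + H 1 + H 0     ≡⟨ cong (2 + e 1 + H 1 +_) H₀ ⟩
    2 + e 1 + H 1 + 0       ≡⟨ +-identityʳ _ ⟩
    2 + e 1 + H 1           ∎

  invariant-step : ∀ {m} → Invariant m → e m ≡ e (suc m) → Balanced (suc m) → Balanced (suc (suc m)) →
                   Invariant (suc (suc m))
  invariant-step {m} inv eₘ≡eₘ₊₁ balanced₁ balanced₂ = +-cancelʳ-≡ (H m₂) _ _ (begin
    S m₃ + e m₂ + H m₂          ≡⟨ +-assoc (S m₃) (e m₂) (H m₂) ⟩
    S m₃ + (e m₂ + H m₂)        ≡⟨ cong (S m₃ +_) (sym S₂≡) ⟩
    S m₃ + S m₂                 ≡⟨ balanced₂ ⟩
    2 + e m₃ + H m₃ + H m₂      ∎)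
    where
    m₁ m₂ m₃ : ℕ
    m₁ = suc m
    m₂ = suc m₁
    m₃ = suc m₂
    S₁≡ : S m₁ ≡ 2 + H m₁
    S₁≡ = +-cancelʳ-≡ (e m) _ _ (begin
      S m₁ + e m                  ≡⟨ inv ⟩
      2 + e m₁ + H m₁             ≡⟨ cong (λ x → 2 + x + H m₁) (sym eₘ≡eₘ₊₁) ⟩
      2 + e m + H m₁              ≡⟨ swap-last 2 (e m) (H m₁) ⟩
      2 + H m₁ + e m              ∎)
      where
      swap-last : ∀ a b c → a + b + c ≡ a + c + b
      swap-last = solve-∀
    S₂≡ : S m₂ ≡ e m₂ + H m₂
    S₂≡ = +-cancelʳ-≡ (2 + H m₁) _ _ (begin
      S m₂ + (2 + H m₁)           ≡⟨ cong (S m₂ +_) (sym S₁≡) ⟩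
      S m₂ + S m₁                 ≡⟨ balanced₁ ⟩
      2 + e m₂ + H m₂ + H m₁      ≡⟨ regroup (e m₂) (H m₂) (H m₁) ⟩
      e m₂ + H m₂ + (2 + H m₁)    ∎)
      where
      regroup : ∀ a b c → 2 + a + b + c ≡ a + b + (2 + c)
      regroup = solve-∀

  invariant-even : ∀ {k} → S 0 ≡ 0 → H 0 ≡ 0 → e 0 ≡ 0 → (∀ y → suc y ≤ k → Balanced y) →
                   (∀ i → suc (2 * i) < k → e (2 * i) ≡ e (suc (2 * i))) →
                   ∀ i → 2 * i < k → Invariant (2 * i)
  invariant-even S₀ H₀ e₀ balanced _ zero 1≤k = invariant-start S₀ H₀ e₀ (balanced 0 1≤k)
  invariant-even {k} S₀ H₀ e₀ balanced alternating (suc i) 2i+2<k =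
    subst Invariant (sym (*-suc 2 i))
      (invariant-step (invariant-even S₀ H₀ e₀ balanced alternating i (≤-trans (n≤1+n _) 2i+1<k))
        (alternating i 2i+1<k) (balanced _ 2i+1<k) (balanced _ 2i+3≤k))
    where
    2i+3≤k : suc (suc (suc (2 * i))) ≤ k
    2i+3≤k = subst (λ m → suc m ≤ k) (*-suc 2 i) 2i+2<k
    2i+1<k : suc (2 * i) < k
    2i+1<k = ≤-trans (n≤1+n _) 2i+3≤k

  invariant-violated : ∀ {m} → Invariant m → S (suc m) ≤ 2 → e m ≡ 0 → e (suc m) ≡ 1 → ⊥
  invariant-violated {m} inv S≤2 eₘ≡0 eₘ₊₁≡1 = 3+h≰2 (subst (_≤ 2) S≡3+H S≤2)
    where
    S≡3+H : S (suc m) ≡ 3 + H (suc m)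
    S≡3+H = begin
      S (suc m)                  ≡⟨ sym (+-identityʳ _) ⟩
      S (suc m) + 0              ≡⟨ cong (S (suc m) +_) (sym eₘ≡0) ⟩
      S (suc m) + e m            ≡⟨ inv ⟩
      2 + e (suc m) + H (suc m)  ≡⟨ cong (λ x → 2 + x + H (suc m)) eₘ₊₁≡1 ⟩
      3 + H (suc m)              ∎
    3+h≰2 : ∀ {h} → ¬ 3 + h ≤ 2
    3+h≰2 (s≤s (s≤s ()))

-- z₁ and z₃ are the edges leaving the grid at the top and the bottom, z₂ and z₄ the endvertex
-- indicators of the outer vertices.
column-balance : ∀ a a′ t b c c′ h h′ e {z₁ z₂ z₃ z₄} → z₁ ≡ 0 → z₂ ≡ 0 → z₃ ≡ 0 → z₄ ≡ 0 →
                 a + a′ + t + z₁ + z₂ ≡ 2 → h + h′ + b + t + e ≡ 2 → c + c′ + z₃ + b + z₄ ≡ 2 →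
                 a + c + (a′ + c′) ≡ 2 + e + h + h′
column-balance a a′ t b c c′ h h′ e refl refl refl refl top middle bottom = +-cancelʳ-≡ (t + b) _ _ (begin
  a + c + (a′ + c′) + (t + b)                          ≡⟨ regroup a a′ t b c c′ ⟩
  (a + a′ + t + 0 + 0) + (c + c′ + 0 + b + 0)          ≡⟨ cong₂ _+_ top bottom ⟩
  2 + 2                                                ≡⟨ cong (2 +_) (sym middle) ⟩
  2 + (h + h′ + b + t + e)                             ≡⟨ regroup′ h h′ b t e ⟩
  2 + e + h + h′ + (t + b)                             ∎)
  where
  regroup : ∀ a a′ t b c c′ → a + c + (a′ + c′) + (t + b) ≡ (a + a′ + t + 0 + 0) + (c + c′ + 0 + b + 0)
  regroup = solve-∀
  regroup′ : ∀ h h′ b t e → 2 + (h + h′ + b + t + e) ≡ 2 + e + h + h′ + (t + b)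
  regroup′ = solve-∀

module Columns {n ps} (C : IsPathCover n ps) (ends-in-row₂ : ∀ v → IsEnd ps v → ∃ λ y → v ≡ (2 , y)) where

  outer middle middleEnd : ℕ → ℕ
  outer y     = horizontal ps 1 y + horizontal ps 3 y
  middle y    = horizontal ps 2 y
  middleEnd y = endCount ps (2 , y)

  outer-≤2 : ∀ y → outer y ≤ 2
  outer-≤2 y = +-mono-≤ (indicator-≤1 (edgeOf? ps _ _)) (indicator-≤1 (edgeOf? ps _ _))

  outer-0 : outer 0 ≡ 0
  outer-0 = cong₂ _+_ (edge-outside _ C λ { (_ , (() , _)) }) (edge-outside _ C λ { (_ , (() , _)) })

  middle-0 : middle 0 ≡ 0
  middle-0 = edge-outside _ C λ { (_ , (() , _)) }

  middleEnd-0 : middleEnd 0 ≡ 0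
  middleEnd-0 = indicator-≡0 (λ end → outside (Any⇒InGrid C EndOf-∈ end)) (isEnd? ps _)
    where
    outside : ¬ InGrid n (2 , 0)
    outside (_ , (() , _))

  endCount-off-row₂ : ∀ {x y} → x ≢ 2 → endCount ps (x , y) ≡ 0
  endCount-off-row₂ x≢2 = indicator-≡0 (λ end → x≢2 (cong proj₁ (proj₂ (ends-in-row₂ _ end)))) (isEnd? ps _)

  balanced : ∀ y → suc y ≤ n → Balanced outer middle middleEnd y
  balanced y Y≤n =
    column-balance (horizontal ps 1 Y) (horizontal ps 1 y) (vertical ps 1 Y) (vertical ps 2 Y)
                   (horizontal ps 3 Y) (horizontal ps 3 y) (horizontal ps 2 Y) (horizontal ps 2 y) (middleEnd Y)
      (edge-outside _ C λ { ((() , _) , _) }) (endCount-off-row₂ λ ())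
      (trans (edge-sym ps _ _) (edge-outside _ C λ { ((_ , s≤s (s≤s (s≤s ()))) , _) })) (endCount-off-row₂ λ ())
      (vertex-balance C ((s≤s z≤n , s≤s z≤n) , (s≤s z≤n , Y≤n)))
      (vertex-balance C ((s≤s z≤n , s≤s (s≤s z≤n)) , (s≤s z≤n , Y≤n)))
      (vertex-balance C ((s≤s z≤n , s≤s (s≤s (s≤s z≤n))) , (s≤s z≤n , Y≤n)))
    where
    Y = suc y

mainTheorem3 : (n : ℕ) → 1 ≤ n → (ps : List (List Vertex)) → IsPathCover n ps →
    ¬ ((∀ v → IsEnd ps v → ∃ λ y → v ≡ (2 , y))
       × (∃ λ k → Odd k × 1 ≤ k × k ≤ n × IsEnd ps (2 , k) × ¬ IsEnd ps (2 , k ∸ 1)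
            × (∀ i → Odd i → 1 ≤ i → i < k → IsEnd ps (2 , i) ⇔ IsEnd ps (2 , i ∸ 1))))
mainTheorem3 n _ ps C (ends-in-row₂ , _ , (j , refl) , _ , k≤n , k-end , k-1-not-end , alternating) =
  invariant-violated outer middle middleEnd
    (invariant-even outer middle middleEnd outer-0 middle-0 middleEnd-0
      (λ y y<k → balanced y (≤-trans y<k k≤n))
      (λ i 2i+1<k → sym (indicator-cong (alternating (suc (2 * i)) (i , refl) (s≤s z≤n) 2i+1<k)
                                        (isEnd? ps _) (isEnd? ps _)))
      j ≤-refl)
    (outer-≤2 _) (indicator-≡0 k-1-not-end (isEnd? ps _)) (indicator-≡1 k-end (isEnd? ps _))
  where open Columns C ends-in-row₂
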